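{- For basic forms $P,Q\in\mathbf{BF}$: $P=_{fr}Q$ if and only if $P$ and $Q$ are syntactically identical.
   Context: Fix a finite non-empty set $A$ of atomic propositions. Closed terms are built from $T$, $F$, $a\in A$ by conditional composition $P\triangleleft Q\triangleright R$. $\mathbf{BF}$ is the smallest set of closed terms containing $T,F$ and closed under $P,Q\mapsto P\triangleleft a\triangleright Q$ for $a\in A$. A reactive valuation algebra (RVA) is a set $RV$ with elements $T_{RV},F_{RV}$ and for each $a\in A$ functions $y_a:RV\to\{T,F\}$, $\partial_a:RV\to RV$ with $y_a(T_{RV})=T$, $y_a(F_{RV})=F$, $\partial_a(T_{RV})=T_{RV}$, $\partial_a(F_{RV})=F_{RV}$. For closed $P$ and $H\in RV$: $T/H=T$, $F/H=F$, $a/H=y_a(H)$, $\partial_T(H)=\partial_F(H)=H$; $(P\triangleleft Q\triangleright R)/H=P/\partial_Q(H)$ and $\partial_{P\triangleleft Q\triangleright R}(H)=\partial_P(\partial_Q(H))$ if $Q/H=T$, and $R/\partial_Q(H)$ resp. $\partial_R(\partial_Q(H))$ if $Q/H=F$. $P\equiv_{fr}Q$ means $P/H=Q/H$ for all RVAs and all $H$; $=_{fr}$ is the largest congruence (w.r.t. conditional composition) on closed terms contained in $\equiv_{fr}$. -}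

module Defs where

open import Data.Nat using (ℕ; suc)
open import Data.Fin using (Fin)
open import Data.Bool using (Bool; true; false)
open import Data.Product using (_×_; _,_; proj₁; proj₂; Σ)
open import Relation.Binary.PropositionalEquality using (_≡_)
open import Relation.Binary.Structures using (IsEquivalence)
open import Level using (Level) renaming (suc to lsuc; zero to lzero)

-- The finite non-empty set A of atoms is represented (up to bijection)
-- as Fin (suc n).
module Terms (n : ℕ) where

  Atom : Set
  Atom = Fin (suc n)

  data Term : Set where
    T F : Term
    atom : Atom → Term
    _◁_▷_ : Term → Term → Term → Term

  data BF : Term → Set where
    bfT : BF T
    bfF : BF F
    bfC : ∀ {P Q} (a : Atom) → BF P → BF Q → BF (P ◁ atom a ▷ Q)

  -- reactive valuation algebras (truth values T,F represented by Bool)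
  record RVA : Set₁ where
    field
      RV   : Set
      TRV  : RV
      FRV  : RV
      y    : Atom → RV → Bool
      ∂    : Atom → RV → RV
      y-T  : ∀ a → y a TRV ≡ true
      y-F  : ∀ a → y a FRV ≡ false
      ∂-T  : ∀ a → ∂ a TRV ≡ TRV
      ∂-F  : ∀ a → ∂ a FRV ≡ FRV

  module _ (V : RVA) where
    open RVA V

    eval : Term → RV → Bool × RV
    eval T H = true , H
    eval F H = false , H
    eval (atom a) H = y a H , ∂ a H
    eval (P ◁ Q ▷ R) H with eval Q H
    ... | true  , H' = eval P H'
    ... | false , H' = eval R H'

    _/_ : Term → RV → Bool
    P / H = proj₁ (eval P H)

    ∂[_] : Term → RV → RV
    ∂[ P ] H = proj₂ (eval P H)

  _≡fr_ : Term → Term → Set₁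
  P ≡fr Q = (V : RVA) (H : RVA.RV V) → _/_ V P H ≡ _/_ V Q H

  record IsCongruence (R : Term → Term → Set₁) : Set₁ where
    field
      isEquivalence : IsEquivalence R
      cong-◁▷ : ∀ {P P' Q Q' S S'} → R P P' → R Q Q' → R S S' →
                R (P ◁ Q ▷ S) (P' ◁ Q' ▷ S')

  -- P =fr Q : related by the largest congruence contained in ≡fr,
  -- i.e. related by some congruence contained in ≡fr.
  _=fr_ : Term → Term → Set₂
  P =fr Q = Σ (Term → Term → Set₁) λ R →
              IsCongruence R × (∀ {X Y} → R X Y → X ≡fr Y) × R P Q

module Submission where

-- Since =fr is a congruence inside ≡fr, P =fr Q makes P and Q interchangeable
-- as the condition of any X ◁ _ ▷ Y.  Two valuation algebras separate basic
-- forms used as conditions: one remembers which atom is queried first, so the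
-- head atoms must agree (and a constant differs from a compound); the other
-- answers the first query with a chosen truth value and afterwards behaves as
-- an arbitrary algebra, so equal heads force the corresponding branches to be
-- interchangeable as conditions again.

open import Defs
open import Data.Bool using (Bool; true; false; if_then_else_)
open import Data.Empty using (⊥-elim)
open import Data.Fin using (zero; _≟_)
open import Data.Nat using (ℕ)
open import Data.Product using (_×_; _,_; proj₁; proj₂; map₂)
open import Function using (_∘_)
open import Level using (Lift; lift)
open import Relation.Binary.PropositionalEquality
  using (_≡_; refl; sym; cong; cong₂; module ≡-Reasoning)
open import Relation.Binary.Structures using (IsEquivalence)
open import Relation.Nullary using (¬_; yes; no; does)
open import Relation.Nullary.Decidable using (dec-true; dec-false)

module BasicForms (n : ℕ) where
  open Terms n
  open ≡-Reasoning

  private variable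
    P Q P₁ P₂ Q₁ Q₂ : Term
    a b : Atom

  true≢false : ¬ true ≡ false
  true≢false ()

  record _≡cond_ (P Q : Term) : Set₁ where
    constructor interchangeable
    field in-context : ∀ X Y → (X ◁ P ▷ Y) ≡fr (X ◁ Q ▷ Y)
  open _≡cond_

  ≡cond-sym : P ≡cond Q → Q ≡cond P
  ≡cond-sym e = interchangeable λ X Y V H → sym (in-context e X Y V H)

  =fr⇒≡cond : P =fr Q → P ≡cond Q
  =fr⇒≡cond (R , isCongruence , R⊆≡fr , RPQ) =
    interchangeable λ X Y → R⊆≡fr (cong-◁▷ R-refl RPQ R-refl)
    where
    open IsCongruence isCongruence
    R-refl : ∀ {X} → R X X
    R-refl = IsEquivalence.refl isEquivalence

  =fr-refl : P =fr P
  =fr-refl = (λ X Y → Lift _ (X ≡ Y))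
           , record
               { isEquivalence = record
                   { refl  = lift refl
                   ; sym   = λ { (lift refl) → lift refl }
                   ; trans = λ { (lift refl) (lift refl) → lift refl }
                   }
               ; cong-◁▷ = λ { (lift refl) (lift refl) (lift refl) → lift refl }
               }
           , (λ { (lift refl) V H → refl })
           , lift refl

  module _ (V : RVA) where
    open RVA V

    eval-fixed : ∀ {H} → (∀ a → ∂ a H ≡ H) → ∀ Z → proj₂ (eval V Z H) ≡ H
    eval-fixed fixed T = refl
    eval-fixed fixed F = refl
    eval-fixed fixed (atom a) = fixed a
    eval-fixed {H} fixed (P ◁ Q ▷ R) with eval V Q H | eval-fixed fixed Q
    ... | true  , _ | refl = eval-fixed fixed P
    ... | false , _ | refl = eval-fixed fixed R

    eval-◁-same : ∀ X Z H → eval V (X ◁ Z ▷ X) H ≡ eval V X (proj₂ (eval V Z H))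
    eval-◁-same X Z H with eval V Z H
    ... | true  , _ = refl
    ... | false , _ = refl

  data FirstQuery : Set where
    start tt ff : FirstQuery
    queried : Atom → FirstQuery

  FirstQueryIs : Atom → RVA
  FirstQueryIs a = record
    { RV = FirstQuery ; TRV = tt ; FRV = ff ; y = answer ; ∂ = record-query
    ; y-T = λ _ → refl ; y-F = λ _ → refl ; ∂-T = λ _ → refl ; ∂-F = λ _ → refl
    }
    where
    answer : Atom → FirstQuery → Bool
    answer _ start       = false
    answer _ tt          = true
    answer _ ff          = false
    answer _ (queried b) = does (b ≟ a)

    record-query : Atom → FirstQuery → FirstQuery
    record-query c start = queried c
    record-query _ s     = s

  probe-compound : ∀ a P b Q →
                   proj₁ (eval (FirstQueryIs a) (atom a ◁ (P ◁ atom b ▷ Q) ▷ atom a) start)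
                   ≡ does (b ≟ a)
  probe-compound a P b Q = begin
    proj₁ (eval V (atom a ◁ (P ◁ atom b ▷ Q) ▷ atom a) start)
      ≡⟨ cong proj₁ (eval-◁-same V (atom a) (P ◁ atom b ▷ Q) start) ⟩
    proj₁ (eval V (atom a) (proj₂ (eval V Q (queried b))))
      ≡⟨ cong (λ H → proj₁ (eval V (atom a) H)) (eval-fixed V (λ _ → refl) Q) ⟩
    does (b ≟ a) ∎
    where V = FirstQueryIs a

  T≢condF : ¬ T ≡cond F
  T≢condF e = true≢false (in-context e T F (FirstQueryIs zero) start)

  -- The hypothesis holds for C = T and C = F: they query no atom.
  constant≢cond-compound : ∀ {C} → proj₂ (eval (FirstQueryIs a) C start) ≡ start →
                           ¬ C ≡cond (P ◁ atom a ▷ Q)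
  constant≢cond-compound {a} {P} {Q} {C} unqueried e = true≢false (begin
    true
      ≡⟨ sym (dec-true (a ≟ a) refl) ⟩
    does (a ≟ a)
      ≡⟨ sym (probe-compound a P a Q) ⟩
    proj₁ (eval V (atom a ◁ (P ◁ atom a ▷ Q) ▷ atom a) start)
      ≡⟨ sym (in-context e (atom a) (atom a) V start) ⟩
    proj₁ (eval V (atom a ◁ C ▷ atom a) start)
      ≡⟨ cong proj₁ (eval-◁-same V (atom a) C start) ⟩
    proj₁ (eval V (atom a) (proj₂ (eval V C start)))
      ≡⟨ cong (λ H → proj₁ (eval V (atom a) H)) unqueried ⟩
    false ∎)
    where V = FirstQueryIs a

  distinct-heads : ¬ a ≡ b → ¬ (P₁ ◁ atom a ▷ P₂) ≡cond (Q₁ ◁ atom b ▷ Q₂)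
  distinct-heads {a} {b} {P₁} {P₂} {Q₁} {Q₂} a≢b e = true≢false (begin
    true
      ≡⟨ sym (dec-true (a ≟ a) refl) ⟩
    does (a ≟ a)
      ≡⟨ sym (probe-compound a P₁ a P₂) ⟩
    proj₁ (eval V (atom a ◁ (P₁ ◁ atom a ▷ P₂) ▷ atom a) start)
      ≡⟨ in-context e (atom a) (atom a) V start ⟩
    proj₁ (eval V (atom a ◁ (Q₁ ◁ atom b ▷ Q₂) ▷ atom a) start)
      ≡⟨ probe-compound a Q₁ b Q₂ ⟩
    does (b ≟ a)
      ≡⟨ dec-false (b ≟ a) (a≢b ∘ sym) ⟩
    false ∎)
    where V = FirstQueryIs a

  data Stage (S : Set) : Set where
    waiting running : S → Stage S

  AnswerFirst : Bool → RVA → RVA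
  AnswerFirst g V = record
    { RV = Stage RV ; TRV = running TRV ; FRV = running FRV ; y = answer ; ∂ = step
    ; y-T = y-T ; y-F = y-F ; ∂-T = cong running ∘ ∂-T ; ∂-F = cong running ∘ ∂-F
    }
    where
    open RVA V
    answer : Atom → Stage RV → Bool
    answer _ (waiting _) = g
    answer a (running H) = y a H

    step : Atom → Stage RV → Stage RV
    step _ (waiting H) = running H
    step a (running H) = running (∂ a H)

  AnswerFirst-running : ∀ g V Z H →
    eval (AnswerFirst g V) Z (running H) ≡ map₂ running (eval V Z H)
  AnswerFirst-running g V T H = refl
  AnswerFirst-running g V F H = refl
  AnswerFirst-running g V (atom a) H = refl
  AnswerFirst-running g V (P ◁ Q ▷ R) H rewrite AnswerFirst-running g V Q H with eval V Q H
  ... | true  , H′ = AnswerFirst-running g V P H′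
  ... | false , H′ = AnswerFirst-running g V R H′

  AnswerFirst-waiting : ∀ g V X P₁ a P₂ Y H →
    eval (AnswerFirst g V) (X ◁ (P₁ ◁ atom a ▷ P₂) ▷ Y) (waiting H)
    ≡ eval (AnswerFirst g V) (X ◁ (if g then P₁ else P₂) ▷ Y) (running H)
  AnswerFirst-waiting true  _ _ _ _ _ _ _ = refl
  AnswerFirst-waiting false _ _ _ _ _ _ _ = refl

  ≡cond-branch : ∀ g → (P₁ ◁ atom a ▷ P₂) ≡cond (Q₁ ◁ atom a ▷ Q₂) →
                 (if g then P₁ else P₂) ≡cond (if g then Q₁ else Q₂)
  ≡cond-branch {P₁} {a} {P₂} {Q₁} {Q₂} g e = interchangeable λ X Y V H →
    let W = AnswerFirst g V in begin
    proj₁ (eval V (X ◁ (if g then P₁ else P₂) ▷ Y) H)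
      ≡⟨ cong proj₁ (sym (AnswerFirst-running g V (X ◁ (if g then P₁ else P₂) ▷ Y) H)) ⟩
    proj₁ (eval W (X ◁ (if g then P₁ else P₂) ▷ Y) (running H))
      ≡⟨ cong proj₁ (sym (AnswerFirst-waiting g V X P₁ a P₂ Y H)) ⟩
    proj₁ (eval W (X ◁ (P₁ ◁ atom a ▷ P₂) ▷ Y) (waiting H))
      ≡⟨ in-context e X Y W (waiting H) ⟩
    proj₁ (eval W (X ◁ (Q₁ ◁ atom a ▷ Q₂) ▷ Y) (waiting H))
      ≡⟨ cong proj₁ (AnswerFirst-waiting g V X Q₁ a Q₂ Y H) ⟩
    proj₁ (eval W (X ◁ (if g then Q₁ else Q₂) ▷ Y) (running H))
      ≡⟨ cong proj₁ (AnswerFirst-running g V (X ◁ (if g then Q₁ else Q₂) ▷ Y) H) ⟩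
    proj₁ (eval V (X ◁ (if g then Q₁ else Q₂) ▷ Y) H) ∎

  ≡cond⇒≡ : BF P → BF Q → P ≡cond Q → P ≡ Q
  ≡cond⇒≡ bfT bfT _ = refl
  ≡cond⇒≡ bfF bfF _ = refl
  ≡cond⇒≡ bfT bfF e = ⊥-elim (T≢condF e)
  ≡cond⇒≡ bfF bfT e = ⊥-elim (T≢condF (≡cond-sym e))
  ≡cond⇒≡ bfT (bfC _ _ _) e = ⊥-elim (constant≢cond-compound refl e)
  ≡cond⇒≡ bfF (bfC _ _ _) e = ⊥-elim (constant≢cond-compound refl e)
  ≡cond⇒≡ (bfC _ _ _) bfT e = ⊥-elim (constant≢cond-compound refl (≡cond-sym e))
  ≡cond⇒≡ (bfC _ _ _) bfF e = ⊥-elim (constant≢cond-compound refl (≡cond-sym e))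
  ≡cond⇒≡ (bfC a p₁ p₂) (bfC b q₁ q₂) e with a ≟ b
  ... | no a≢b  = ⊥-elim (distinct-heads a≢b e)
  ... | yes refl = cong₂ (λ L R → L ◁ atom a ▷ R)
                     (≡cond⇒≡ p₁ q₁ (≡cond-branch true e))
                     (≡cond⇒≡ p₂ q₂ (≡cond-branch false e))

  =fr⇒≡ : BF P → BF Q → P =fr Q → P ≡ Q
  =fr⇒≡ p q = ≡cond⇒≡ p q ∘ =fr⇒≡cond

mainTheorem19 : (n : ℕ) → let open Terms n in
    ∀ {P Q : Term} → BF P → BF Q → ((P =fr Q → P ≡ Q) × (P ≡ Q → P =fr Q))
mainTheorem19 n p q = BasicForms.=fr⇒≡ n p q , λ { refl → BasicForms.=fr-refl n }
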